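{- Let $k$ be a positive integer and let $(a,b,c)$ be a good triple of positive integers with $a+b+c=n=4k$. Then $a=2k=n/2$.
   Context: For positive integers $a,b,c$ with $n=a+b+c$, the permutation of the triple $(a,b,c)$ is the permutation of $[n]$ with $p_i=n+1-i$ for $1\le i\le a$, $p_i=a+b+1-i$ for $a+1\le i\le a+b$, and $p_i=n+b+1-i$ for $a+b+1\le i\le n$ (one-line notation $n\cdots(n-a+1)\ b\cdots1\ (b+c)\cdots(b+1)$). The triple is good if this permutation, as a bijection $i\mapsto p_i$ of $[n]$, is a single $n$-cycle. No ordering between $b$ and $c$ is assumed. -}

module Defs where

open import Data.Nat using (ℕ; zero; suc; _+_; _∸_; _≤_; _<_; _≤ᵇ_)
open import Data.Bool using (if_then_else_)
open import Data.Product using (∃-syntax; _×_)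
open import Relation.Binary.PropositionalEquality using (_≡_)

-- The permutation of the triple (a,b,c), n = a+b+c, in one-line notation
--   p_i = n+1-i        for 1 ≤ i ≤ a
--   p_i = a+b+1-i      for a+1 ≤ i ≤ a+b
--   p_i = n+b+1-i      for a+b+1 ≤ i ≤ n
-- (values outside [1,n] are irrelevant; the function is only used on [1,n]).
triplePerm : ℕ → ℕ → ℕ → ℕ → ℕ
triplePerm a b c i =
  if i ≤ᵇ a then (a + b + c + 1) ∸ i
  else if i ≤ᵇ a + b then (a + b + 1) ∸ i
  else (a + b + c + b + 1) ∸ i

iter : (ℕ → ℕ) → ℕ → ℕ → ℕ
iter f zero x = x
iter f (suc m) x = f (iter f m x)

-- A bijection p of [n] = {1,…,n} is a single n-cycle iff the cycle
-- (orbit) of the element 1 is all of [n].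
IsNCycle : ℕ → (ℕ → ℕ) → Set
IsNCycle n p = ∀ i → 1 ≤ i → i ≤ n → ∃[ m ] (iter p m 1 ≡ i)

Good : ℕ → ℕ → ℕ → Set
Good a b c = (1 ≤ a) × (1 ≤ b) × (1 ≤ c) × IsNCycle (a + b + c) (triplePerm a b c)

module Submission where

-- Write p for the permutation of (a, b, c) and m = b + c.  On each of its
-- three blocks p reverses order, so p x + x is constant there.
--
-- * a > 2k: the first block swaps 2k and 2k + 1 while the other blocks land
--   in [1,m] with m < 2k; hence the complement of {2k, 2k + 1} is invariant
--   and the orbit of 1 misses 2k.
-- * a < 2k: then a < m.  The first-return map g of p to the window [1,m]
--   factors as g = S ∘ h, where h reverses [1,a] and fixes (a,m], and S is
--   the reflection x ↦ a + b + 1 − x of ℤ/mℤ.  So h ∘ g ∘ h = g⁻¹, and if p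
--   is an n-cycle then g is an m-cycle on [1,m].  A reflection of a cycle
--   fixes at most two points, but h fixes a + 1, a + 2 and either a + 3 or,
--   when a + 1 = 2k, the centre k of [1,a].

open import Defs
open import Data.Nat
open import Data.Nat.Properties
open import Data.Nat.Induction using (<-rec)
open import Data.Nat.DivMod using (_%_; _/_; m≡m%n+[m/n]*n; m%n<n)
open import Data.Empty using (⊥; ⊥-elim)
open import Data.Product using (∃-syntax; _×_; _,_; proj₁; proj₂)
open import Data.Sum using (_⊎_; inj₁; inj₂)
open import Relation.Nullary using (¬_; Dec; yes; no)
open import Relation.Nullary.Decidable using (_×-dec_)
open import Relation.Binary.PropositionalEquality
open import Relation.Binary.Definitions using (tri<; tri≈; tri>)
open import Data.Bool using (true; false; T; if_then_else_)
open import Data.Bool.Properties using (T-≡)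
open import Data.Unit using (tt)
open import Function.Bundles using (Equivalence)
open import Data.Nat.Tactic.RingSolver using (solve-∀)

summand-positive : ∀ {y x K} → y + x ≡ K → x < K → 1 ≤ y
summand-positive {zero}  refl x<x = ⊥-elim (<-irrefl refl x<x)
summand-positive {suc y} _    _   = s≤s z≤n

summand-bounded : ∀ {y x K L U} → y + x ≡ K → L ≤ x → K ≤ U + L → y ≤ U
summand-bounded {y} {x} {K} {L} {U} e L≤x K≤U+L =
  +-cancelʳ-≤ L y U (≤-trans (+-monoʳ-≤ y L≤x) (≤-trans (≤-reflexive e) K≤U+L))

halve-≤ : ∀ {u v} → u + u ≤ v + v → u ≤ v
halve-≤ {u} {v} 2u≤2v with u ≤? v
... | yes u≤v = u≤v
... | no u≰v = ⊥-elim (<⇒≱ (+-mono-< (≰⇒> u≰v) (≰⇒> u≰v)) 2u≤2v)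

halve-≡ : ∀ {u v} → u + u ≡ v + v → u ≡ v
halve-≡ e = ≤-antisym (halve-≤ (≤-reflexive e)) (halve-≤ (≤-reflexive (sym e)))

half-below : ∀ {k a} → 1 ≤ k → k + k ≡ suc a → k ≤ a
half-below {k} k≥1 k+k≡1+a = ≤-pred (≤-trans (+-monoˡ-≤ k k≥1) (≤-reflexive k+k≡1+a))

window-gap : ∀ {m y y′ q q′} → 1 ≤ y′ → y ≤ m → q < q′ → y + q * m ≢ y′ + q′ * m
window-gap {m} {y} {y′} {q} {q′} y′≥1 y≤m q<q′ e = <-irrefl refl (begin-strict
  y + q * m         ≤⟨ +-monoˡ-≤ (q * m) y≤m ⟩
  m + q * m         <⟨ m<n+m (m + q * m) y′≥1 ⟩
  y′ + (m + q * m)  ≤⟨ +-monoʳ-≤ y′ (*-monoˡ-≤ m q<q′) ⟩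
  y′ + q′ * m       ≡⟨ e ⟨
  y + q * m         ∎)
  where open ≤-Reasoning

window-unique : ∀ {m y y′} q q′ → 1 ≤ y × y ≤ m → 1 ≤ y′ × y′ ≤ m →
                y + q * m ≡ y′ + q′ * m → y ≡ y′
window-unique {m} {y} {y′} q q′ (y≥1 , y≤m) (y′≥1 , y′≤m) e with <-cmp q q′
... | tri< q<q′ _ _ = ⊥-elim (window-gap y′≥1 y≤m q<q′ e)
... | tri≈ _ q≡q′ _ = +-cancelʳ-≡ (q * m) y y′ (trans e (cong (λ r → y′ + r * m) (sym q≡q′)))
... | tri> _ _ q>q′ = ⊥-elim (window-gap y≥1 y′≤m q>q′ (sym e))

cross-cancel : ∀ y y′ u {s r r′} → y + u ≡ s + r → y′ + u ≡ s + r′ → y + r′ ≡ y′ + r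
cross-cancel y y′ u {s} {r} {r′} e e′ = +-cancelʳ-≡ u (y + r′) (y′ + r) (begin
  y + r′ + u    ≡⟨ swap y r′ u ⟩
  y + u + r′    ≡⟨ cong (_+ r′) e ⟩
  s + r + r′    ≡⟨ swap s r r′ ⟩
  s + r′ + r    ≡⟨ cong (_+ r) e′ ⟨
  y′ + u + r    ≡⟨ swap y′ u r ⟩
  y′ + r + u    ∎)
  where
  open ≡-Reasoning
  swap : ∀ x y z → x + y + z ≡ x + z + y
  swap = solve-∀

-- A self-map S of the window [1,m] with S x + x ≡ s (mod m) for all x is an
-- involution: S (S x) and x both complement S x modulo m.  (The shift by m
-- keeps the sums from having to be reduced by subtraction.)
reflection-invol : ∀ (S : ℕ → ℕ) {m s} →
                   (∀ {x} → 1 ≤ x × x ≤ m → 1 ≤ S x × S x ≤ m) →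
                   (∀ {x} → 1 ≤ x × x ≤ m → ∃[ q ] S x + (x + m) ≡ s + q * m) →
                   ∀ {x} → 1 ≤ x × x ≤ m → S (S x) ≡ x
reflection-invol S {m} {s} S-window S-sum {x} x-W with S-sum x-W | S-sum (S-window x-W)
... | q , e | q′ , e′ = window-unique q q′ (S-window (S-window x-W)) x-W (cross-cancel (S (S x)) x (S x + m) e′ e″)
  where
  arith : ∀ x y m → x + (y + m) ≡ y + (x + m)
  arith = solve-∀
  e″ : x + (S x + m) ≡ s + q * m
  e″ = trans (arith x (S x) m) e

iter-+ : ∀ (f : ℕ → ℕ) s t x → iter f (s + t) x ≡ iter f s (iter f t x)
iter-+ f zero    t x = refl
iter-+ f (suc s) t x = cong f (iter-+ f s t x)

iter-swap : ∀ (f : ℕ → ℕ) s t x → iter f s (iter f t x) ≡ iter f t (iter f s x)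
iter-swap f s t x = begin
  iter f s (iter f t x) ≡⟨ iter-+ f s t x ⟨
  iter f (s + t) x      ≡⟨ cong (λ u → iter f u x) (+-comm s t) ⟩
  iter f (t + s) x      ≡⟨ iter-+ f t s x ⟩
  iter f t (iter f s x) ∎
  where open ≡-Reasoning

iter-preserves : ∀ (f : ℕ → ℕ) (I : ℕ → Set) → (∀ {x} → I x → I (f x)) →
                 ∀ t {x} → I x → I (iter f t x)
iter-preserves f I step zero    Ix = Ix
iter-preserves f I step (suc t) Ix = step (iter-preserves f I step t Ix)

iter-periodic : ∀ (f : ℕ → ℕ) {P x} → iter f P x ≡ x → ∀ q → iter f (q * P) x ≡ x
iter-periodic f e zero = refl
iter-periodic f {P} {x} e (suc q) =
  trans (iter-+ f P (q * P) x) (trans (cong (iter f P) (iter-periodic f e q)) e)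

iter-mod : ∀ (f : ℕ → ℕ) {P x} .{{_ : NonZero P}} → iter f P x ≡ x →
           ∀ s → iter f s x ≡ iter f (s % P) x
iter-mod f {P} {x} e s = begin
  iter f s x                              ≡⟨ cong (λ u → iter f u x) (m≡m%n+[m/n]*n s P) ⟩
  iter f (s % P + (s / P) * P) x          ≡⟨ iter-+ f (s % P) ((s / P) * P) x ⟩
  iter f (s % P) (iter f ((s / P) * P) x) ≡⟨ cong (iter f (s % P)) (iter-periodic f e (s / P)) ⟩
  iter f (s % P) x                        ∎
  where open ≡-Reasoning

record MinimalPeriod (f : ℕ → ℕ) (x : ℕ) : Set where
  field
    period   : ℕ
    positive : 0 < period
    returns  : iter f period x ≡ x
    minimal  : ∀ r → 0 < r → r < period → iter f r x ≢ x

minimal-period : ∀ (f : ℕ → ℕ) x P → 0 < P → iter f P x ≡ x → MinimalPeriod f x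
minimal-period f x = <-rec (λ P → 0 < P → iter f P x ≡ x → MinimalPeriod f x) descend
  where
  returns? : ∀ r → Dec (0 < r × iter f r x ≡ x)
  returns? r = (0 <? r) ×-dec (iter f r x ≟ x)
  descend : ∀ P → (∀ {r} → r < P → 0 < r → iter f r x ≡ x → MinimalPeriod f x) →
            0 < P → iter f P x ≡ x → MinimalPeriod f x
  descend P smaller P>0 ret with anyUpTo? returns? P
  ... | yes (r , r<P , r>0 , ret-r) = smaller r<P r>0 ret-r
  ... | no none = record
    { period = P ; positive = P>0 ; returns = ret
    ; minimal = λ r r>0 r<P ret-r → none (r , r<P , r>0 , ret-r) }

module _ {f : ℕ → ℕ} {x : ℕ} (M : MinimalPeriod f x) where
  open MinimalPeriod M renaming (period to Q)

  period-below-double : ∀ t → 0 < t → t < Q + Q → iter f t x ≡ x → t ≡ Q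
  period-below-double t t>0 t<2Q ret with <-cmp t Q
  ... | tri< t<Q _ _ = ⊥-elim (minimal t t>0 t<Q ret)
  ... | tri≈ _ t≡Q _ = t≡Q
  ... | tri> _ _ t>Q = ⊥-elim (minimal (t ∸ Q) (m<n⇒0<n∸m t>Q) t∸Q<Q ret-t∸Q)
    where
    t∸Q+Q≡t : t ∸ Q + Q ≡ t
    t∸Q+Q≡t = m∸n+n≡m (<⇒≤ t>Q)
    t∸Q<Q : t ∸ Q < Q
    t∸Q<Q = +-cancelʳ-< Q (t ∸ Q) Q (subst (_< Q + Q) (sym t∸Q+Q≡t) t<2Q)
    ret-t∸Q : iter f (t ∸ Q) x ≡ x
    ret-t∸Q = begin
      iter f (t ∸ Q) x            ≡⟨ cong (iter f (t ∸ Q)) returns ⟨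
      iter f (t ∸ Q) (iter f Q x) ≡⟨ iter-+ f (t ∸ Q) Q x ⟨
      iter f (t ∸ Q + Q) x        ≡⟨ cong (λ u → iter f u x) t∸Q+Q≡t ⟩
      iter f t x                  ≡⟨ ret ⟩
      x                           ∎
      where open ≡-Reasoning

-- If the
-- f-orbit of one point o is all of D, then h has at most two fixed points
-- in D: a reflection of a cycle fixes at most two antipodal points.
module CycleReflection
  (f h : ℕ → ℕ) (D : ℕ → Set)
  (f-D : ∀ {x} → D x → D (f x))
  (h-D : ∀ {x} → D x → D (h x))
  (h-invol : ∀ {x} → D x → h (h x) ≡ x)
  (reflect : ∀ {x} → D x → f (h (f x)) ≡ h x)
  (o : ℕ) (o-D : D o) (cover : ∀ y → D y → ∃[ t ] iter f t o ≡ y)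
  where

  reflect-iter : ∀ t {u} → D u → iter f t (h (iter f t u)) ≡ h u
  reflect-iter zero    _   = refl
  reflect-iter (suc t) {u} u-D = begin
    f (iter f t (h (f (iter f t u)))) ≡⟨ iter-swap f 1 t _ ⟩
    iter f t (f (h (f (iter f t u)))) ≡⟨ cong (iter f t) (reflect (iter-preserves f D f-D t u-D)) ⟩
    iter f t (h (iter f t u))         ≡⟨ reflect-iter t u-D ⟩
    h u                               ∎
    where open ≡-Reasoning

  -- o has the preimage h (f (h o)) in D, which lies on its orbit; so o is periodic.
  o-periodic : ∃[ t ] iter f (suc t) o ≡ o
  o-periodic with cover (h (f (h o))) (h-D (f-D (h-D o-D)))
  ... | t , e = t , trans (cong f e) (trans (reflect (h-D o-D)) (h-invol o-D))

  module _ {x : ℕ} (x-D : D x) where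
    private
      t = proj₁ o-periodic
      i = proj₁ (cover x x-D)
      o-ret : iter f (suc t) o ≡ o
      o-ret = proj₂ o-periodic
      x-from-o : iter f i o ≡ x
      x-from-o = proj₂ (cover x x-D)

    x-periodic : iter f (suc t) x ≡ x
    x-periodic = begin
      iter f (suc t) x            ≡⟨ cong (iter f (suc t)) x-from-o ⟨
      iter f (suc t) (iter f i o) ≡⟨ iter-swap f (suc t) i o ⟩
      iter f i (iter f (suc t) o) ≡⟨ cong (iter f i) o-ret ⟩
      iter f i o                  ≡⟨ x-from-o ⟩
      x                           ∎
      where open ≡-Reasoning

    o-from-x : iter f (t * i) x ≡ o
    o-from-x = begin
      iter f (t * i) x               ≡⟨ cong (iter f (t * i)) x-from-o ⟨
      iter f (t * i) (iter f i o)    ≡⟨ iter-+ f (t * i) i o ⟨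
      iter f (t * i + i) o           ≡⟨ cong (λ u → iter f u o) (arith t i) ⟩
      iter f (i * suc t) o           ≡⟨ iter-periodic f o-ret i ⟩
      o                              ∎
      where
      open ≡-Reasoning
      arith : ∀ t i → t * i + i ≡ i * suc t
      arith = solve-∀

    x-cover : ∀ y → D y → ∃[ s ] iter f s x ≡ y
    x-cover y y-D with cover y y-D
    ... | s , e = s + t * i , trans (iter-+ f s (t * i) x) (trans (cong (iter f s) o-from-x) e)

  module _ {x : ℕ} (x-D : D x) (x-fixed : h x ≡ x) where
    minimal-period-of-x : MinimalPeriod f x
    minimal-period-of-x = minimal-period f x (suc (proj₁ o-periodic)) (s≤s z≤n) (x-periodic x-D)

    open MinimalPeriod minimal-period-of-x renaming (period to Q)

    antipodal : ∀ {y} → D y → h y ≡ y → y ≢ x → ∃[ j ] (j + j ≡ Q × iter f j x ≡ y)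
    antipodal {y} y-D y-fixed y≢x with x-cover x-D y y-D
    ... | s , x→y = j , j+j≡Q , x→y′
      where
      instance
        Q-nonZero : NonZero Q
        Q-nonZero = >-nonZero positive
      j : ℕ
      j = s % Q
      x→y′ : iter f j x ≡ y
      x→y′ = trans (sym (iter-mod f returns s)) x→y
      j>0 : 0 < j
      j>0 = n≢0⇒n>0 λ { j≡0 → y≢x (trans (sym x→y′) (cong (λ u → iter f u x) j≡0)) }
      y→x : iter f j y ≡ x
      y→x = begin
        iter f j y                   ≡⟨ cong (iter f j) y-fixed ⟨
        iter f j (h y)               ≡⟨ cong (λ u → iter f j (h u)) x→y′ ⟨
        iter f j (h (iter f j x))    ≡⟨ reflect-iter j x-D ⟩
        h x                          ≡⟨ x-fixed ⟩
        x                            ∎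
        where open ≡-Reasoning
      j+j≡Q : j + j ≡ Q
      j+j≡Q = period-below-double minimal-period-of-x (j + j)
                (<-≤-trans j>0 (m≤m+n j j)) (+-mono-< (m%n<n s Q) (m%n<n s Q))
                (trans (iter-+ f j j x) (trans (cong (iter f j) x→y′) y→x))

  same-antipode : ∀ {x Q y z} → ∃[ j ] (j + j ≡ Q × iter f j x ≡ y) →
                  ∃[ l ] (l + l ≡ Q × iter f l x ≡ z) → y ≡ z
  same-antipode {x} (j , j+j≡Q , x→y) (l , l+l≡Q , x→z) =
    trans (sym x→y) (trans (cong (λ u → iter f u x) (halve-≡ {j} {l} (trans j+j≡Q (sym l+l≡Q)))) x→z)

  at-most-two-fixed-points : ∀ {x y z} → D x → D y → D z → h x ≡ x → h y ≡ y → h z ≡ z →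
                             y ≢ x → z ≢ x → y ≢ z → ⊥
  at-most-two-fixed-points x-D y-D z-D x-fixed y-fixed z-fixed y≢x z≢x y≢z =
    y≢z (same-antipode (antipodal x-D x-fixed y-D y-fixed y≢x) (antipodal x-D x-fixed z-D z-fixed z≢x))

≤ᵇ-true : ∀ {x y} → x ≤ y → (x ≤ᵇ y) ≡ true
≤ᵇ-true x≤y = Equivalence.to T-≡ (≤⇒≤ᵇ x≤y)

≤ᵇ-false : ∀ {x y} → y < x → (x ≤ᵇ y) ≡ false
≤ᵇ-false {x} {y} y<x with x ≤ᵇ y in eq
... | true  = ⊥-elim (<⇒≱ y<x (≤ᵇ⇒≤ x y (subst T (sym eq) tt)))
... | false = refl

module Triple (a b c : ℕ) where
  p : ℕ → ℕ
  p = triplePerm a b c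

  n m : ℕ
  n = a + b + c
  m = b + c

  m≤n : m ≤ n
  m≤n = ≤-trans (m≤n+m m a) (≤-reflexive (sym (+-assoc a b c)))

  p-head : ∀ {x} → x ≤ a → p x + x ≡ n + 1
  p-head {x} x≤a rewrite ≤ᵇ-true x≤a =
    m∸n+n≡m (≤-trans x≤a (≤-trans (m≤m+n a b) (≤-trans (m≤m+n (a + b) c) (m≤m+n n 1))))

  p-middle : ∀ {x} → a < x → x ≤ a + b → p x + x ≡ a + b + 1
  p-middle {x} a<x x≤a+b rewrite ≤ᵇ-false a<x | ≤ᵇ-true x≤a+b =
    m∸n+n≡m (≤-trans x≤a+b (m≤m+n (a + b) 1))

  p-tail : ∀ {x} → a + b < x → x ≤ n → p x + x ≡ n + b + 1
  p-tail {x} a+b<x x≤n rewrite ≤ᵇ-false (≤-trans (s≤s (m≤m+n a b)) a+b<x) | ≤ᵇ-false a+b<x =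
    m∸n+n≡m (≤-trans x≤n (≤-trans (m≤m+n n b) (m≤m+n (n + b) 1)))

  p-head-large : ∀ {x} → x ≤ a → m < p x
  p-head-large {x} x≤a = +-cancelʳ-< x m (p x) (begin-strict
    m + x     ≤⟨ +-monoʳ-≤ m x≤a ⟩
    m + a     ≡⟨ arith a b c ⟩
    n         <⟨ n<1+n n ⟩
    suc n     ≡⟨ +-comm 1 n ⟩
    n + 1     ≡⟨ p-head x≤a ⟨
    p x + x   ∎)
    where
    open ≤-Reasoning
    arith : ∀ a b c → b + c + a ≡ a + b + c
    arith = solve-∀

  p-rest-range : ∀ {x} → a < x → x ≤ n → 1 ≤ p x × p x ≤ m
  p-rest-range {x} a<x x≤n with x ≤? a + b
  ... | yes x≤a+b = summand-positive e (≤-trans (s≤s x≤a+b) (≤-reflexive (+-comm 1 (a + b))))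
                  , ≤-trans (summand-bounded e a<x (≤-reflexive (arith a b))) (m≤m+n b c)
    where
    e : p x + x ≡ a + b + 1
    e = p-middle a<x x≤a+b
    arith : ∀ a b → a + b + 1 ≡ b + suc a
    arith = solve-∀
  ... | no x≰a+b = summand-positive e x<n+b+1 , summand-bounded e a+b<x (≤-reflexive (arith a b c))
    where
    a+b<x : a + b < x
    a+b<x = ≰⇒> x≰a+b
    e : p x + x ≡ n + b + 1
    e = p-tail a+b<x x≤n
    x<n+b+1 : x < n + b + 1
    x<n+b+1 = ≤-trans (s≤s (≤-trans x≤n (m≤m+n n b))) (≤-reflexive (+-comm 1 (n + b)))
    arith : ∀ a b c → a + b + c + b + 1 ≡ b + c + suc (a + b)
    arith = solve-∀

  p-rest-sum : ∀ {x} → a < x → x ≤ n → ∃[ q ] p x + x ≡ a + b + 1 + q * m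
  p-rest-sum {x} a<x x≤n with x ≤? a + b
  ... | yes x≤a+b = 0 , trans (p-middle a<x x≤a+b) (sym (+-identityʳ (a + b + 1)))
  ... | no x≰a+b = 1 , trans (p-tail (≰⇒> x≰a+b) x≤n) (arith a b c)
    where
    arith : ∀ a b c → a + b + c + b + 1 ≡ a + b + 1 + 1 * (b + c)
    arith = solve-∀

  -- If n = K + K, the first block swaps K and K + 1.  When both lie in the
  -- first block and the other blocks are mapped below K, the complement of
  -- {K, K + 1} in [1,n] is p-invariant, so the orbit of 1 never reaches K.
  module _ {K : ℕ} (2≤K : 2 ≤ K) (n≡K+K : n ≡ K + K) (m<K : m < K) (K<a : K < a) where
    AvoidsPair : ℕ → Set
    AvoidsPair x = 1 ≤ x × x ≤ n × x ≢ K × x ≢ suc K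

    avoids-pair-step : ∀ {x} → AvoidsPair x → AvoidsPair (p x)
    avoids-pair-step {x} (x≥1 , x≤n , x≢K , x≢1+K) with x ≤? a
    ... | yes x≤a = summand-positive e x<n+1 , summand-bounded e x≥1 ≤-refl , px≢K , px≢1+K
      where
      e : p x + x ≡ n + 1
      e = p-head x≤a
      x<n+1 : x < n + 1
      x<n+1 = ≤-trans (s≤s x≤n) (≤-reflexive (+-comm 1 n))
      e′ : p x + x ≡ K + suc K
      e′ = trans e (trans (cong (_+ 1) n≡K+K) (arith K))
        where arith : ∀ K → K + K + 1 ≡ K + suc K
              arith = solve-∀
      px≢K : p x ≢ K
      px≢K px≡K = x≢1+K (+-cancelˡ-≡ K x (suc K) (trans (cong (_+ x) (sym px≡K)) e′))
      px≢1+K : p x ≢ suc K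
      px≢1+K px≡1+K = x≢K (+-cancelˡ-≡ (suc K) x K
                        (trans (cong (_+ x) (sym px≡1+K)) (trans e′ (+-comm K (suc K)))))
    ... | no x≰a = px≥1 , ≤-trans px≤m m≤n , <⇒≢ px<K , <⇒≢ (m≤n⇒m≤1+n px<K)
      where
      px≥1 : 1 ≤ p x
      px≥1 = proj₁ (p-rest-range (≰⇒> x≰a) x≤n)
      px≤m : p x ≤ m
      px≤m = proj₂ (p-rest-range (≰⇒> x≰a) x≤n)
      px<K : p x < K
      px<K = ≤-<-trans px≤m m<K

    K≤n : K ≤ n
    K≤n = ≤-trans (<⇒≤ K<a) (≤-trans (m≤m+n a b) (m≤m+n (a + b) c))

    swapped-pair-not-cyclic : ¬ IsNCycle n p
    swapped-pair-not-cyclic cyc with cyc K (≤-trans (s≤s z≤n) 2≤K) K≤n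
    ... | t , 1→K = proj₁ (proj₂ (proj₂ (iter-preserves p AvoidsPair avoids-pair-step t start))) 1→K
      where
      start : AvoidsPair 1
      start = ≤-refl , ≤-trans (≤-trans (s≤s z≤n) 2≤K) K≤n
            , <⇒≢ 2≤K , <⇒≢ (m≤n⇒m≤1+n 2≤K)

  -- The first-return map g of p to [1,m] (a point of the first block is sent
  -- above m by p, and back into [1,m] by a second application), and the
  -- involution h reversing the first block and fixing everything else.
  g h : ℕ → ℕ
  g x = if x ≤ᵇ a then p (p x) else p x
  h x = if x ≤ᵇ a then suc a ∸ x else x

  g-head : ∀ {x} → x ≤ a → g x ≡ p (p x)
  g-head x≤a rewrite ≤ᵇ-true x≤a = refl

  g-rest : ∀ {x} → a < x → g x ≡ p x
  g-rest a<x rewrite ≤ᵇ-false a<x = refl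

  h-head : ∀ {x} → x ≤ a → h x ≡ suc a ∸ x
  h-head x≤a rewrite ≤ᵇ-true x≤a = refl

  h-rest : ∀ {x} → a < x → h x ≡ x
  h-rest a<x rewrite ≤ᵇ-false a<x = refl

  centre-fixed : ∀ {k} → 1 ≤ k → k + k ≡ suc a → h k ≡ k
  centre-fixed {k} k≥1 k+k≡1+a = begin
    h k             ≡⟨ h-head (half-below k≥1 k+k≡1+a) ⟩
    suc a ∸ k       ≡⟨ cong (_∸ k) k+k≡1+a ⟨
    k + k ∸ k       ≡⟨ m+n∸n≡m k k ⟩
    k               ∎
    where open ≡-Reasoning

  p-orbit-via-g : ∀ t → ∃[ j ] (iter p t 1 ≡ iter g j 1 ⊎ (iter g j 1 ≤ a × iter p t 1 ≡ p (iter g j 1)))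
  p-orbit-via-g zero = 0 , inj₁ refl
  p-orbit-via-g (suc t) with p-orbit-via-g t
  ... | j , inj₁ e with iter g j 1 ≤? a
  ...   | yes y≤a = j , inj₂ (y≤a , cong p e)
  ...   | no y≰a = suc j , inj₁ (trans (cong p e) (sym (g-rest (≰⇒> y≰a))))
  p-orbit-via-g (suc t) | j , inj₂ (y≤a , e) = suc j , inj₁ (trans (cong p e) (sym (g-head y≤a)))

  g-orbit-covers : IsNCycle n p → ∀ y → 1 ≤ y × y ≤ m → ∃[ j ] iter g j 1 ≡ y
  g-orbit-covers cyc y (y≥1 , y≤m) with cyc y y≥1 (≤-trans y≤m m≤n)
  ... | t , 1→y with p-orbit-via-g t
  ... | j , inj₁ e = j , trans (sym e) 1→y
  ... | j , inj₂ (z≤a , e) = ⊥-elim (<⇒≱ (p-head-large z≤a) (subst (_≤ m) (trans (sym 1→y) e) y≤m))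

  module ShortFirstBlock (a<m : a < m) where
    Window : ℕ → Set
    Window x = 1 ≤ x × x ≤ m

    h-head-sum : ∀ {x} → x ≤ a → h x + x ≡ suc a
    h-head-sum x≤a rewrite h-head x≤a = m∸n+n≡m (m≤n⇒m≤1+n x≤a)

    h-head-range : ∀ {x} → 1 ≤ x → x ≤ a → 1 ≤ h x × h x ≤ a
    h-head-range {x} x≥1 x≤a = summand-positive (h-head-sum x≤a) (s≤s x≤a)
                             , summand-bounded (h-head-sum x≤a) x≥1 (≤-reflexive (+-comm 1 a))

    h-window : ∀ {x} → Window x → Window (h x)
    h-window {x} (x≥1 , x≤m) with x ≤? a
    ... | yes x≤a = proj₁ (h-head-range x≥1 x≤a) , ≤-trans (proj₂ (h-head-range x≥1 x≤a)) (<⇒≤ a<m)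
    ... | no x≰a = subst Window (sym (h-rest (≰⇒> x≰a))) (x≥1 , x≤m)

    h-invol : ∀ {x} → Window x → h (h x) ≡ x
    h-invol {x} (x≥1 , _) with x ≤? a
    ... | yes x≤a = +-cancelʳ-≡ (h x) (h (h x)) x (begin
      h (h x) + h x ≡⟨ h-head-sum (proj₂ (h-head-range x≥1 x≤a)) ⟩
      suc a         ≡⟨ h-head-sum x≤a ⟨
      h x + x       ≡⟨ +-comm (h x) x ⟩
      x + h x       ∎)
      where open ≡-Reasoning
    ... | no x≰a = trans (cong h (h-rest (≰⇒> x≰a))) (h-rest (≰⇒> x≰a))

    -- S = g ∘ h acts on [1,m] as the reflection x ↦ a + b + 1 − x of ℤ/mℤ.
    S : ℕ → ℕ
    S x = g (h x)

    p-h-head : ∀ {x} → 1 ≤ x → x ≤ a → p (h x) ≡ x + m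
    p-h-head {x} x≥1 x≤a = +-cancelʳ-≡ (h x) (p (h x)) (x + m) (begin
      p (h x) + h x  ≡⟨ p-head (proj₂ (h-head-range x≥1 x≤a)) ⟩
      n + 1          ≡⟨ arith a b c ⟩
      m + suc a      ≡⟨ cong (m +_) (h-head-sum x≤a) ⟨
      m + (h x + x)  ≡⟨ arith′ m (h x) x ⟩
      x + m + h x    ∎)
      where
      open ≡-Reasoning
      arith : ∀ a b c → a + b + c + 1 ≡ b + c + suc a
      arith = solve-∀
      arith′ : ∀ m y x → m + (y + x) ≡ x + m + y
      arith′ = solve-∀

    shifted-range : ∀ {x} → x ≤ a → a < x + m × x + m ≤ n
    shifted-range {x} x≤a = <-≤-trans a<m (m≤n+m m x)
                          , ≤-trans (+-monoˡ-≤ m x≤a) (≤-reflexive (sym (+-assoc a b c)))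

    S-head : ∀ {x} → 1 ≤ x → x ≤ a → S x ≡ p (x + m)
    S-head x≥1 x≤a = trans (g-head (proj₂ (h-head-range x≥1 x≤a))) (cong p (p-h-head x≥1 x≤a))

    S-rest : ∀ {x} → a < x → S x ≡ p x
    S-rest a<x = trans (cong g (h-rest a<x)) (g-rest a<x)

    S-window : ∀ {x} → Window x → Window (S x)
    S-window {x} (x≥1 , x≤m) with x ≤? a
    ... | yes x≤a = subst Window (sym (S-head x≥1 x≤a))
                      (p-rest-range (proj₁ (shifted-range x≤a)) (proj₂ (shifted-range x≤a)))
    ... | no x≰a = subst Window (sym (S-rest (≰⇒> x≰a))) (p-rest-range (≰⇒> x≰a) (≤-trans x≤m m≤n))

    S-sum : ∀ {x} → Window x → ∃[ q ] S x + (x + m) ≡ a + b + 1 + q * m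
    S-sum {x} (x≥1 , x≤m) with x ≤? a
    ... | yes x≤a with p-rest-sum (proj₁ (shifted-range x≤a)) (proj₂ (shifted-range x≤a))
    ...   | q , e = q , trans (cong (_+ (x + m)) (S-head x≥1 x≤a)) e
    S-sum {x} (x≥1 , x≤m) | no x≰a with p-rest-sum (≰⇒> x≰a) (≤-trans x≤m m≤n)
    ...   | q , e = suc q , (begin
      S x + (x + m)  ≡⟨ cong (_+ (x + m)) (S-rest (≰⇒> x≰a)) ⟩
      p x + (x + m)  ≡⟨ +-assoc (p x) x m ⟨
      p x + x + m    ≡⟨ cong (_+ m) e ⟩
      a + b + 1 + q * m + m ≡⟨ arith (a + b + 1) q m ⟩
      a + b + 1 + suc q * m ∎)
      where
      open ≡-Reasoning
      arith : ∀ s q m → s + q * m + m ≡ s + suc q * m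
      arith = solve-∀

    S-invol : ∀ {x} → Window x → S (S x) ≡ x
    S-invol = reflection-invol S S-window S-sum

    g-via-S : ∀ {x} → Window x → g x ≡ S (h x)
    g-via-S x-W = cong g (sym (h-invol x-W))

    g-window : ∀ {x} → Window x → Window (g x)
    g-window x-W = subst Window (sym (g-via-S x-W)) (S-window (h-window x-W))

    -- g = S ∘ h with S, h involutions, hence h ∘ g ∘ h = g⁻¹.
    g-reflect : ∀ {x} → Window x → g (h (g x)) ≡ h x
    g-reflect x-W = trans (cong S (g-via-S x-W)) (S-invol (h-window x-W))

    three-fixed-points-not-cyclic : ∀ {x y z} → Window x → Window y → Window z →
                                    h x ≡ x → h y ≡ y → h z ≡ z → y ≢ x → z ≢ x → y ≢ z →
                                    ¬ IsNCycle n p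
    three-fixed-points-not-cyclic x-W y-W z-W x-fixed y-fixed z-fixed y≢x z≢x y≢z cyc =
      CycleReflection.at-most-two-fixed-points g h Window g-window h-window h-invol g-reflect
        1 (≤-refl , ≤-<-trans z≤n a<m) (g-orbit-covers cyc)
        x-W y-W z-W x-fixed y-fixed z-fixed y≢x z≢x y≢z

  a<a+1 : a < suc a
  a<a+1 = n<1+n a

  a+1<a+2 : suc a < suc (suc a)
  a+1<a+2 = n<1+n (suc a)

  a+2<a+3 : suc (suc a) < suc (suc (suc a))
  a+2<a+3 = n<1+n (suc (suc a))

  long-rest-not-cyclic : suc (suc (suc a)) ≤ m → ¬ IsNCycle n p
  long-rest-not-cyclic a+3≤m = three-fixed-points-not-cyclic
    (s≤s z≤n , a+1≤m) (s≤s z≤n , a+2≤m) (s≤s z≤n , a+3≤m)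
    (h-rest a<a+1) (h-rest a<a+2) (h-rest (<-trans a<a+2 a+2<a+3))
    (>⇒≢ a+1<a+2) (>⇒≢ (<-trans a+1<a+2 a+2<a+3)) (<⇒≢ a+2<a+3)
    where
    a<a+2 : a < suc (suc a)
    a<a+2 = <-trans a<a+1 a+1<a+2
    a+2≤m : suc (suc a) ≤ m
    a+2≤m = ≤-trans (n≤1+n _) a+3≤m
    a+1≤m : a < m
    a+1≤m = ≤-trans (n≤1+n _) a+2≤m
    open ShortFirstBlock a+1≤m

  centred-not-cyclic : ∀ {k} → 1 ≤ k → k + k ≡ suc a → suc (suc a) ≤ m → ¬ IsNCycle n p
  centred-not-cyclic {k} k≥1 k+k≡1+a a+2≤m = three-fixed-points-not-cyclic
    (s≤s z≤n , a+1≤m) (s≤s z≤n , a+2≤m) (k≥1 , ≤-trans k≤a (<⇒≤ a+1≤m))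
    (h-rest a<a+1) (h-rest (<-trans a<a+1 a+1<a+2)) (centre-fixed k≥1 k+k≡1+a)
    (>⇒≢ a+1<a+2) (<⇒≢ (s≤s k≤a)) (>⇒≢ (<-trans (s≤s k≤a) a+1<a+2))
    where
    k≤a : k ≤ a
    k≤a = half-below k≥1 k+k≡1+a
    a+1≤m : a < m
    a+1≤m = ≤-trans (n≤1+n _) a+2≤m
    open ShortFirstBlock a+1≤m

  n≡a+m : n ≡ a + m
  n≡a+m = +-assoc a b c

  short-first-block-not-cyclic : ∀ {k} → 1 ≤ k → n ≡ 4 * k → a < 2 * k → ¬ IsNCycle n p
  short-first-block-not-cyclic {k} k≥1 n≡4k a<2k with suc (suc (suc a)) ≤? m
  ... | yes a+3≤m = long-rest-not-cyclic a+3≤m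
  ... | no a+3≰m = centred-not-cyclic k≥1 (trans (sym (double k)) 2k≡1+a) a+2≤m
    where
    double : ∀ k → 2 * k ≡ k + k
    double = solve-∀
    a+m≡2k+2k : a + m ≡ 2 * k + 2 * k
    a+m≡2k+2k = trans (sym n≡a+m) (trans n≡4k (arith k))
      where arith : ∀ k → 4 * k ≡ 2 * k + 2 * k
            arith = solve-∀
    -- m ≤ a + 2 forces 2k = a + 1, and then m = a + 2.
    2k≤1+a : 2 * k ≤ suc a
    2k≤1+a = halve-≤ (begin
      2 * k + 2 * k          ≡⟨ a+m≡2k+2k ⟨
      a + m                  ≤⟨ +-monoʳ-≤ a (≤-pred (≰⇒> a+3≰m)) ⟩
      a + suc (suc a)        ≡⟨ +-suc a (suc a) ⟩
      suc a + suc a          ∎)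
      where open ≤-Reasoning
    2k≡1+a : 2 * k ≡ suc a
    2k≡1+a = ≤-antisym 2k≤1+a a<2k
    a+2≤m : suc (suc a) ≤ m
    a+2≤m = ≤-reflexive (+-cancelˡ-≡ a (suc (suc a)) m (begin
      a + suc (suc a)        ≡⟨ +-suc a (suc a) ⟩
      suc a + suc a          ≡⟨ cong₂ _+_ 2k≡1+a 2k≡1+a ⟨
      2 * k + 2 * k          ≡⟨ a+m≡2k+2k ⟨
      a + m                  ∎))
      where open ≡-Reasoning

  long-first-block-not-cyclic : ∀ {K} → 2 ≤ K → n ≡ K + K → K < a → ¬ IsNCycle n p
  long-first-block-not-cyclic {K} 2≤K n≡K+K K<a = swapped-pair-not-cyclic 2≤K n≡K+K m<K K<a
    where
    m<K : m < K
    m<K = +-cancelˡ-< K m K (begin-strict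
      K + m      <⟨ +-monoˡ-< m K<a ⟩
      a + m      ≡⟨ n≡a+m ⟨
      n          ≡⟨ n≡K+K ⟩
      K + K      ∎)
      where open ≤-Reasoning

proposition14 : (k a b c : ℕ) → 1 ≤ k → a + b + c ≡ 4 * k → Good a b c → a ≡ 2 * k
proposition14 k a b c k≥1 n≡4k (_ , _ , _ , cyclic) with <-cmp a (2 * k)
... | tri< a<2k _ _ = ⊥-elim (Triple.short-first-block-not-cyclic a b c k≥1 n≡4k a<2k cyclic)
... | tri≈ _ a≡2k _ = a≡2k
... | tri> _ _ a>2k =
  ⊥-elim (Triple.long-first-block-not-cyclic a b c (*-monoʳ-≤ 2 k≥1) (trans n≡4k (four k)) a>2k cyclic)
  where
  four : ∀ k → 4 * k ≡ 2 * k + 2 * k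
  four = solve-∀
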